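{- Let $w$ be a word of length $n$ with $m$ blocks. Then for every fixed length, $w$ contains at most $m$ pairwise nonequivalent Abelian squares of that length. Consequently, $\mathit{SQ}'_{\mathrm{Abel}}(w)\le \frac{nm}{2}$.
   Context: A block of $w$ is a maximal fragment $w[i..j]$ all of whose letters are equal (it cannot be extended to the left or right). For a word $x$ over $\{0,\ldots,\sigma-1\}$, $P(x)=(|x|_0,\ldots,|x|_{\sigma-1})$ is its Parikh vector. An Abelian square is a word $uv$ with $u,v$ nonempty, $|u|=|v|$ and $P(u)=P(v)$; two Abelian squares are equivalent if they have the same Parikh vector. $\mathit{SQ}'_{\mathrm{Abel}}(w)$ is the number of pairwise nonequivalent Abelian squares occurring as subwords (contiguous factors) of $w$. -}

module Defs where

open import Data.Nat using (ℕ; zero; suc; _+_; _*_; _∸_; _≤_)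
import Data.Nat as ℕ
open import Data.Fin using (Fin)
import Data.Fin as Fin
open import Data.Vec using (Vec; tabulate)
open import Data.Vec.Properties using (≡-dec)
open import Data.List using (List; []; _∷_; length; take; drop; map; filter; deduplicate; concatMap; upTo; applyUpTo)
import Data.List as List
open import Data.Bool using (Bool; true; false; if_then_else_; _∧_)
open import Relation.Nullary using (Dec; yes; no; does; ¬_)
open import Relation.Binary.PropositionalEquality using (_≡_)

Word : ℕ → Set
Word σ = List (Fin σ)

occ : ∀ {σ} → Fin σ → Word σ → ℕ
occ a [] = 0
occ a (b ∷ x) = if does (a Fin.≟ b) then suc (occ a x) else occ a x

Parikh : ∀ {σ} → Word σ → Vec ℕ σ
Parikh x = tabulate (λ a → occ a x)

_≟P_ : ∀ {σ} (p q : Vec ℕ σ) → Dec (p ≡ q)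
_≟P_ = ≡-dec ℕ._≟_

blocks : ∀ {σ} → Word σ → ℕ
blocks [] = 0
blocks (a ∷ []) = 1
blocks (a ∷ b ∷ w) = if does (a Fin.≟ b) then blocks (b ∷ w) else suc (blocks (b ∷ w))

sqFactor : ∀ {σ} → Word σ → ℕ → ℕ → Word σ
sqFactor w i h = take (h + h) (drop i w)

isAbSqAt : ∀ {σ} → Word σ → ℕ → ℕ → Bool
isAbSqAt w i h with 1 ℕ.≤? h | i + (h + h) ℕ.≤? length w
... | yes _ | yes _ = does (Parikh (take h (sqFactor w i h)) ≟P Parikh (drop h (sqFactor w i h)))
... | _     | _     = false

abSqParikhs : ∀ {σ} → (ℕ → Bool) → Word σ → List (Vec ℕ σ)
abSqParikhs ok w =
  concatMap (λ i →
    concatMap (λ h →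
      if isAbSqAt w i h ∧ ok (h + h) then Parikh (sqFactor w i h) ∷ [] else [])
    (upTo (suc (length w))))
  (upTo (suc (length w)))

-- SQ'_Abel(w): number of pairwise nonequivalent Abelian squares in w
-- (equivalence = equal Parikh vectors).
SQAbel : ∀ {σ} → Word σ → ℕ
SQAbel w = length (deduplicate _≟P_ (abSqParikhs (λ _ → true) w))

SQAbelOfLength : ∀ {σ} → Word σ → ℕ → ℕ
SQAbelOfLength w ℓ = length (deduplicate _≟P_ (abSqParikhs (λ k → does (k ℕ.≟ ℓ)) w))

-- Two Abelian squares of the same half-length h, starting at i and i + d, whose
-- centres i + h and i + d + h lie in one block, have equal Parikh vectors: sliding
-- the window of length 2h by d removes w[i, i+d) and adds w[i+2h, i+2h+d), and the
-- two square conditions force these to sum to twice the unary segment w[i+h, i+h+d),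
-- so both equal it.  Hence the block of the centre determines the Parikh vector of
-- a square of given length, giving at most m classes per length; as the half-length
-- ranges over 1, …, ⌊n/2⌋, there are at most ⌊n/2⌋ m classes in total.
module Submission where

open import Defs
open import Data.Nat using (ℕ; _*_; _≤_)
open import Data.List using (length)
open import Data.Product using (_×_)

open import Data.Bool using (Bool; true; false; if_then_else_; _∧_)
open import Data.Bool.Properties using (∧-conicalˡ; ∧-conicalʳ)
open import Data.Empty using (⊥-elim)
open import Data.Fin as Fin using (Fin; fromℕ<; combine)
open import Data.Fin.Properties using (pigeonhole; combine-injective; fromℕ<-injective)
open import Data.List using (List; []; _∷_; _++_; take; drop; replicate; deduplicate; upTo; lookup)
open import Data.List.Properties using (take++drop≡id; take-take; take-drop; drop-drop; length-take)
open import Data.List.Membership.Propositional using (_∈_)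
open import Data.List.Membership.Propositional.Properties using (∈-lookup; ∈-concatMap⁻; ∈-deduplicate⁻)
open import Data.List.Relation.Unary.Any using (here; satisfied)
open import Data.List.Relation.Unary.All as All using ()
open import Data.List.Relation.Unary.AllPairs using (_∷_)
open import Data.List.Relation.Unary.Unique.Propositional using (Unique)
open import Data.List.Relation.Unary.Unique.DecPropositional.Properties using (deduplicate-!)
open import Data.Nat using (zero; suc; _+_; _∸_; _<_; _<?_; _≟_; _⊓_; z≤n; s≤s; ⌊_/2⌋; ⌈_/2⌉)
open import Data.Nat.Properties
open import Data.Nat.Tactic.RingSolver using (solve-∀)
open import Algebra.Properties.CommutativeSemigroup +-commutativeSemigroup using (xy∙z≈xz∙y)
open import Data.Product using (∃; _,_; proj₂)
open import Data.Sum using (inj₁; inj₂)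
open import Data.Vec as Vec using (Vec)
open import Data.Vec.Properties using (tabulate-cong; lookup∘tabulate)
open import Function using (_∘_)
open import Relation.Binary.Definitions using (DecidableEquality)
open import Relation.Nullary using (Dec; yes; no; does)
open import Relation.Binary.PropositionalEquality

module _ {a} {A : Set a} where

  Unique⇒lookup-≢ : ∀ {xs : List A} → Unique xs → ∀ {i j} → i Fin.< j → lookup xs i ≢ lookup xs j
  Unique⇒lookup-≢ {_ ∷ _} (x∉xs ∷ _) {Fin.zero} {Fin.suc j} _ = All.lookup x∉xs (∈-lookup j)
  Unique⇒lookup-≢ {_ ∷ _} (_ ∷ u) {Fin.suc i} {Fin.suc j} (s≤s i<j) = Unique⇒lookup-≢ u i<j

  length-unique≤ : ∀ {K} {xs : List A} → Unique xs → (key : ∀ {x} → x ∈ xs → Fin K) →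
                   (∀ {x y} (p : x ∈ xs) (q : y ∈ xs) → key p ≡ key q → x ≡ y) →
                   length xs ≤ K
  length-unique≤ {K} {xs} u key key-injective with K <? length xs
  ... | no K≮n = ≮⇒≥ K≮n
  ... | yes K<n with pigeonhole K<n (λ i → key (∈-lookup i))
  ... | _ , _ , i<j , same = ⊥-elim (Unique⇒lookup-≢ u i<j (key-injective _ _ same))

  length-deduplicate≤ : ∀ {K} (_≟_ : DecidableEquality A) (xs : List A) →
                        (key : ∀ {x} → x ∈ xs → Fin K) →
                        (∀ {x y} (p : x ∈ xs) (q : y ∈ xs) → key p ≡ key q → x ≡ y) →
                        length (deduplicate _≟_ xs) ≤ K
  length-deduplicate≤ _≟_ xs key key-injective =
    length-unique≤ (deduplicate-! _≟_ xs) (λ p → key (∈-deduplicate⁻ _≟_ xs p))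
                   (λ p q → key-injective _ _)

  take-take-+ : ∀ m n (xs : List A) → take m (take (m + n) xs) ≡ take m xs
  take-take-+ m n xs = trans (take-take m (m + n) xs) (cong (λ k → take k xs) (m≤n⇒m⊓n≡m (m≤m+n m n)))

  take-+ : ∀ m n (xs : List A) → take (m + n) xs ≡ take m xs ++ take n (drop m xs)
  take-+ m n xs = begin
    take (m + n) xs                                        ≡⟨ take++drop≡id m _ ⟨
    take m (take (m + n) xs) ++ drop m (take (m + n) xs)  ≡⟨ cong₂ _++_ (take-take-+ m n xs) (sym (take-drop n m xs)) ⟩
    take m xs ++ take n (drop m xs)                        ∎
    where open ≡-Reasoning

does⇒ : ∀ {p} {P : Set p} (P? : Dec P) → does P? ≡ true → P
does⇒ (yes p) _ = p

∈-if-singleton⁻ : ∀ {a} {A : Set a} (b : Bool) {x y : A} →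
                  x ∈ (if b then y ∷ [] else []) → b ≡ true × x ≡ y
∈-if-singleton⁻ true (here x≡y) = refl , x≡y

m+n≡o+o⇒m≡o : ∀ {m n o} → m ≤ o → n ≤ o → m + n ≡ o + o → m ≡ o
m+n≡o+o⇒m≡o {m} {n} {o} m≤o n≤o m+n≡o+o = ≤-antisym m≤o (+-cancelʳ-≤ o o m (begin
  o + o  ≡⟨ m+n≡o+o ⟨
  m + n  ≤⟨ +-monoʳ-≤ m n≤o ⟩
  m + o  ∎))
  where open ≤-Reasoning

m+m≡n+n⇒m≡n : ∀ {m n} → m + m ≡ n + n → m ≡ n
m+m≡n+n⇒m≡n {m} {n} eq = begin
  m                ≡⟨ n≡⌊n+n/2⌋ m ⟩
  ⌊ m + m /2⌋      ≡⟨ cong ⌊_/2⌋ eq ⟩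
  ⌊ n + n /2⌋      ≡⟨ n≡⌊n+n/2⌋ n ⟨
  n                ∎
  where open ≡-Reasoning

2*⌊n/2⌋≤n : ∀ n → 2 * ⌊ n /2⌋ ≤ n
2*⌊n/2⌋≤n n = begin
  ⌊ n /2⌋ + (⌊ n /2⌋ + 0)  ≡⟨ cong (⌊ n /2⌋ +_) (+-identityʳ ⌊ n /2⌋) ⟩
  ⌊ n /2⌋ + ⌊ n /2⌋        ≤⟨ +-monoʳ-≤ ⌊ n /2⌋ (⌊n/2⌋≤⌈n/2⌉ n) ⟩
  ⌊ n /2⌋ + ⌈ n /2⌉        ≡⟨ ⌊n/2⌋+⌈n/2⌉≡n n ⟩
  n                        ∎
  where open ≤-Reasoning

module _ {σ : ℕ} where

  occ-++ : ∀ (a : Fin σ) xs ys → occ a (xs ++ ys) ≡ occ a xs + occ a ys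
  occ-++ a []       ys = refl
  occ-++ a (b ∷ xs) ys with does (a Fin.≟ b)
  ... | true  = cong suc (occ-++ a xs ys)
  ... | false = occ-++ a xs ys

  occ≤length : ∀ (a : Fin σ) xs → occ a xs ≤ length xs
  occ≤length a []       = z≤n
  occ≤length a (b ∷ xs) with does (a Fin.≟ b)
  ... | true  = s≤s (occ≤length a xs)
  ... | false = m≤n⇒m≤1+n (occ≤length a xs)

  occ-replicate-self : ∀ (c : Fin σ) d → occ c (replicate d c) ≡ d
  occ-replicate-self c zero = refl
  occ-replicate-self c (suc d) with c Fin.≟ c
  ... | yes _   = cong suc (occ-replicate-self c d)
  ... | no c≢c = ⊥-elim (c≢c refl)

  occ-replicate-other : ∀ {a c : Fin σ} → a ≢ c → ∀ d → occ a (replicate d c) ≡ 0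
  occ-replicate-other a≢c zero = refl
  occ-replicate-other {a} {c} a≢c (suc d) with a Fin.≟ c
  ... | yes a≡c = ⊥-elim (a≢c a≡c)
  ... | no _    = occ-replicate-other a≢c d

  Parikh-≡⇒occ-≡ : ∀ (x y : Word σ) → Parikh x ≡ Parikh y → ∀ a → occ a x ≡ occ a y
  Parikh-≡⇒occ-≡ x y eq a = begin
    occ a x                  ≡⟨ lookup∘tabulate (λ b → occ b x) a ⟨
    Vec.lookup (Parikh x) a  ≡⟨ cong (λ v → Vec.lookup v a) eq ⟩
    Vec.lookup (Parikh y) a  ≡⟨ lookup∘tabulate (λ b → occ b y) a ⟩
    occ a y                  ∎
    where open ≡-Reasoning

  segOcc : Fin σ → Word σ → ℕ → ℕ → ℕ
  segOcc a w i d = occ a (take d (drop i w))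

  segOcc-+ : ∀ a w i d e → segOcc a w i (d + e) ≡ segOcc a w i d + segOcc a w (i + d) e
  segOcc-+ a w i d e = begin
    occ a (take (d + e) (drop i w))                          ≡⟨ cong (occ a) (take-+ d e (drop i w)) ⟩
    occ a (take d (drop i w) ++ take e (drop d (drop i w)))  ≡⟨ occ-++ a (take d (drop i w)) _ ⟩
    segOcc a w i d + occ a (take e (drop d (drop i w)))      ≡⟨ cong (λ v → segOcc a w i d + occ a (take e v)) (drop-drop i d w) ⟩
    segOcc a w i d + segOcc a w (i + d) e                    ∎
    where open ≡-Reasoning

  segOcc-slide : ∀ a w i d e →
                 segOcc a w i d + segOcc a w (i + d) e ≡ segOcc a w i e + segOcc a w (i + e) d
  segOcc-slide a w i d e =
    trans (sym (segOcc-+ a w i d e)) (trans (cong (segOcc a w i) (+-comm d e)) (segOcc-+ a w i e d))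

  segOcc≤ : ∀ a w i d → segOcc a w i d ≤ d
  segOcc≤ a w i d = begin
    segOcc a w i d             ≤⟨ occ≤length a (take d (drop i w)) ⟩
    length (take d (drop i w)) ≡⟨ length-take d (drop i w) ⟩
    d ⊓ length (drop i w)      ≤⟨ m⊓n≤m d _ ⟩
    d                          ∎
    where open ≤-Reasoning

  record AbelianSquareAt (w : Word σ) (i h : ℕ) : Set where
    field
      half-positive : 1 ≤ h
      inside        : i + (h + h) ≤ length w
      balanced      : ∀ a → segOcc a w i h ≡ segOcc a w (i + h) h

  open AbelianSquareAt

  centre<length : ∀ {w i h} → AbelianSquareAt w i h → i + h < length w
  centre<length {i = i} {h} sq = ≤-trans (+-monoʳ-< i (m<m+n h (half-positive sq))) (inside sq)

  isAbSqAt-sound : ∀ w i h → isAbSqAt w i h ≡ true → AbelianSquareAt w i h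
  isAbSqAt-sound w i h isSq with 1 ≤? h | i + (h + h) ≤? length w
  ... | yes h≥1 | yes fits = record
    { half-positive = h≥1
    ; inside        = fits
    ; balanced      = λ a → begin
        occ a (take h (drop i w))                 ≡⟨ cong (occ a) (take-take-+ h h (drop i w)) ⟨
        occ a (take h (sqFactor w i h))           ≡⟨ Parikh-≡⇒occ-≡ (take h (sqFactor w i h)) (drop h (sqFactor w i h)) (does⇒ (_ ≟P _) isSq) a ⟩
        occ a (drop h (sqFactor w i h))           ≡⟨ cong (occ a) (take-drop h h (drop i w)) ⟨
        occ a (take h (drop h (drop i w)))        ≡⟨ cong (λ v → occ a (take h v)) (drop-drop i h w) ⟩
        occ a (take h (drop (i + h) w))           ∎
    }
    where open ≡-Reasoning

  blockIndex : Word σ → ℕ → ℕ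
  blockIndex w           zero    = 0
  blockIndex []          (suc p) = 0
  blockIndex (a ∷ [])    (suc p) = 0
  blockIndex (a ∷ b ∷ w) (suc p) =
    if does (a Fin.≟ b) then blockIndex (b ∷ w) p else suc (blockIndex (b ∷ w) p)

  blocks-positive : ∀ a (w : Word σ) → 1 ≤ blocks (a ∷ w)
  blocks-positive a []      = s≤s z≤n
  blocks-positive a (b ∷ w) with does (a Fin.≟ b)
  ... | true  = blocks-positive b w
  ... | false = s≤s z≤n

  blockIndex<blocks : ∀ w p → p < length w → blockIndex w p < blocks w
  blockIndex<blocks (a ∷ w)     zero    _         = blocks-positive a w
  blockIndex<blocks (a ∷ b ∷ w) (suc p) (s≤s p<n) with does (a Fin.≟ b)
  ... | true  = blockIndex<blocks (b ∷ w) p p<n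
  ... | false = s≤s (blockIndex<blocks (b ∷ w) p p<n)

  firstBlock⇒replicate : ∀ a w d → d < length (a ∷ w) → blockIndex (a ∷ w) d ≡ 0 →
                         take d (a ∷ w) ≡ replicate d a
  firstBlock⇒replicate a w       zero    _         _ = refl
  firstBlock⇒replicate a (b ∷ w) (suc d) (s≤s d<n) inFirst with a Fin.≟ b
  ... | yes refl = cong (a ∷_) (firstBlock⇒replicate a w d d<n inFirst)

  sameBlock⇒replicate : ∀ w p d → p + d < length w → blockIndex w p ≡ blockIndex w (p + d) →
                        ∃ λ c → take d (drop p w) ≡ replicate d c
  sameBlock⇒replicate (a ∷ w)     zero    d d<n same = a , firstBlock⇒replicate a w d d<n (sym same)
  sameBlock⇒replicate (a ∷ b ∷ w) (suc p) d (s≤s p+d<n) same with does (a Fin.≟ b)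
  ... | true  = sameBlock⇒replicate (b ∷ w) p d p+d<n same
  ... | false = sameBlock⇒replicate (b ∷ w) p d p+d<n (suc-injective same)

  balanced-replicate : ∀ {a c : Fin σ} {d X Y} → X ≤ d → Y ≤ d →
                       X + Y ≡ occ a (replicate d c) + occ a (replicate d c) → X ≡ Y
  balanced-replicate {a} {c} {d} {X} {Y} X≤d Y≤d sum with a Fin.≟ c
  ... | yes refl = trans (m+n≡o+o⇒m≡o X≤d Y≤d sum′) (sym (m+n≡o+o⇒m≡o Y≤d X≤d (trans (+-comm Y X) sum′)))
    where sum′ = trans sum (cong (λ m → m + m) (occ-replicate-self a d))
  ... | no a≢c = trans (m+n≡0⇒m≡0 X sum′) (sym (m+n≡0⇒n≡0 X sum′))
    where sum′ = trans sum (cong (λ m → m + m) (occ-replicate-other a≢c d))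

  squaresInBlock⇒segOcc-≡ : ∀ {w i d h c} a →
    segOcc a w i h ≡ segOcc a w (i + h) h →
    segOcc a w (i + d) h ≡ segOcc a w (i + d + h) h →
    take d (drop (i + h) w) ≡ replicate d c →
    segOcc a w (i + d) (h + h) ≡ segOcc a w i (h + h)
  squaresInBlock⇒segOcc-≡ {w} {i} {d} {h} {c} a squareᵢ squareⱼ unary =
    +-cancelˡ-≡ X _ _ (begin
      X + segOcc a w (i + d) (h + h)  ≡⟨ segOcc-slide a w i d (h + h) ⟩
      segOcc a w i (h + h) + Y        ≡⟨ cong (segOcc a w i (h + h) +_) X≡Y ⟨
      segOcc a w i (h + h) + X        ≡⟨ +-comm _ X ⟩
      X + segOcc a w i (h + h)        ∎)
    where
      open ≡-Reasoning
      X M Y A B : ℕ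
      X = segOcc a w i d
      M = segOcc a w (i + h) d
      Y = segOcc a w (i + (h + h)) d
      A = segOcc a w i h
      B = segOcc a w (i + d) h

      enter : X + B ≡ A + M
      enter = segOcc-slide a w i d h

      leave : M + B ≡ A + Y
      leave = begin
        M + B                                            ≡⟨ cong (M +_) (trans squareⱼ (cong (λ p → segOcc a w p h) (xy∙z≈xz∙y i d h))) ⟩
        M + segOcc a w (i + h + d) h                     ≡⟨ segOcc-slide a w (i + h) d h ⟩
        segOcc a w (i + h) h + segOcc a w (i + h + h) d  ≡⟨ cong₂ _+_ (sym squareᵢ) (cong (λ p → segOcc a w p d) (+-assoc i h h)) ⟩
        A + Y                                            ∎

      interchange : ∀ x y a b → x + y + (a + b) ≡ (x + b) + (a + y)
      interchange = solve-∀

      regroup : ∀ a m b → (a + m) + (m + b) ≡ m + m + (a + b)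
      regroup = solve-∀

      X+Y≡M+M : X + Y ≡ M + M
      X+Y≡M+M = +-cancelʳ-≡ (A + B) _ _ (begin
        X + Y + (A + B)    ≡⟨ interchange X Y A B ⟩
        (X + B) + (A + Y)  ≡⟨ cong₂ _+_ enter (sym leave) ⟩
        (A + M) + (M + B)  ≡⟨ regroup A M B ⟩
        M + M + (A + B)    ∎)

      X≡Y : X ≡ Y
      X≡Y = balanced-replicate (segOcc≤ a w i d) (segOcc≤ a w (i + (h + h)) d)
              (trans X+Y≡M+M (cong (λ m → m + m) (cong (occ a) unary)))

  shiftedSquares⇒Parikh-≡ : ∀ {w i d h} → AbelianSquareAt w i h → AbelianSquareAt w (i + d) h →
    blockIndex w (i + h) ≡ blockIndex w (i + d + h) →
    Parikh (sqFactor w (i + d) h) ≡ Parikh (sqFactor w i h)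
  shiftedSquares⇒Parikh-≡ {w} {i} {d} {h} squareᵢ squareⱼ same =
    tabulate-cong (λ a → squaresInBlock⇒segOcc-≡ {w} {i} {d} {h} a (balanced squareᵢ a) (balanced squareⱼ a) (proj₂ unary))
    where
      unary : ∃ λ c → take d (drop (i + h) w) ≡ replicate d c
      unary = sameBlock⇒replicate w (i + h) d
                (subst (_< length w) (xy∙z≈xz∙y i d h) (centre<length squareⱼ))
                (trans same (cong (blockIndex w) (xy∙z≈xz∙y i d h)))

  sameCentreBlock⇒Parikh-≡ : ∀ {w i j h} → AbelianSquareAt w i h → AbelianSquareAt w j h →
    blockIndex w (i + h) ≡ blockIndex w (j + h) →
    Parikh (sqFactor w i h) ≡ Parikh (sqFactor w j h)
  sameCentreBlock⇒Parikh-≡ {i = i} {j} squareᵢ squareⱼ same with ≤-total i j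
  ... | inj₁ i≤j with d , refl ← m≤n⇒∃[o]m+o≡n i≤j = sym (shiftedSquares⇒Parikh-≡ squareᵢ squareⱼ same)
  ... | inj₂ j≤i with d , refl ← m≤n⇒∃[o]m+o≡n j≤i = shiftedSquares⇒Parikh-≡ squareⱼ squareᵢ (sym same)

  record Occurrence (ok : ℕ → Bool) (w : Word σ) (x : Vec ℕ σ) : Set where
    field
      start half : ℕ
      square     : AbelianSquareAt w start half
      length-ok  : ok (half + half) ≡ true
      parikh     : x ≡ Parikh (sqFactor w start half)

  open Occurrence

  ∈-abSqParikhs⁻ : ∀ ok w {x} → x ∈ abSqParikhs ok w → Occurrence ok w x
  ∈-abSqParikhs⁻ ok w x∈
    with i , x∈ᵢ ← satisfied (∈-concatMap⁻ _ {xs = upTo (suc (length w))} x∈)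
    with h , x∈ᵢₕ ← satisfied (∈-concatMap⁻ _ {xs = upTo (suc (length w))} x∈ᵢ)
    with listed , x≡ ← ∈-if-singleton⁻ (isAbSqAt w i h ∧ ok (h + h)) x∈ᵢₕ
    = record
      { start     = i
      ; half      = h
      ; square    = isAbSqAt-sound w i h (∧-conicalˡ _ _ listed)
      ; length-ok = ∧-conicalʳ _ _ listed
      ; parikh    = x≡
      }

  Occurrence-≡ : ∀ {ok w x y} (o : Occurrence ok w x) (o′ : Occurrence ok w y) →
    half o ≡ half o′ → blockIndex w (start o + half o) ≡ blockIndex w (start o′ + half o′) → x ≡ y
  Occurrence-≡ record { square = sq ; parikh = refl } record { square = sq′ ; parikh = refl } refl same =
    sameCentreBlock⇒Parikh-≡ sq sq′ same

  length-deduplicate-abSqParikhs≤ : ∀ {ok w K} (code : ∀ {x} → Occurrence ok w x → Fin K) →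
    (∀ {x y} (o : Occurrence ok w x) (o′ : Occurrence ok w y) → code o ≡ code o′ → half o ≡ half o′) →
    length (deduplicate _≟P_ (abSqParikhs ok w)) ≤ K * blocks w
  length-deduplicate-abSqParikhs≤ {ok} {w} {K} code code-injective =
    length-deduplicate≤ _≟P_ (abSqParikhs ok w) (key ∘ ∈-abSqParikhs⁻ ok w)
      (λ p q → key-injective (∈-abSqParikhs⁻ ok w p) (∈-abSqParikhs⁻ ok w q))
    where
      centreBlock : ∀ {x} → Occurrence ok w x → Fin (blocks w)
      centreBlock o = fromℕ< (blockIndex<blocks w _ (centre<length (square o)))

      key : ∀ {x} → Occurrence ok w x → Fin (K * blocks w)
      key o = combine (code o) (centreBlock o)

      key-injective : ∀ {x y} (o : Occurrence ok w x) (o′ : Occurrence ok w y) → key o ≡ key o′ → x ≡ y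
      key-injective o o′ same
        with sameCode , sameBlock ← combine-injective (code o) (centreBlock o) (code o′) (centreBlock o′) same =
        Occurrence-≡ o o′ (code-injective o o′ sameCode) (fromℕ<-injective _ _ _ _ sameBlock)

  half∸1<⌊length/2⌋ : ∀ {w i h} → AbelianSquareAt w i h → h ∸ 1 < ⌊ length w /2⌋
  half∸1<⌊length/2⌋ {h = zero} sq with () ← half-positive sq
  half∸1<⌊length/2⌋ {w} {i} {suc k} sq = begin
    suc k                ≡⟨ n≡⌊n+n/2⌋ (suc k) ⟩
    ⌊ suc k + suc k /2⌋  ≤⟨ ⌊n/2⌋-mono (≤-trans (m≤n+m _ i) (inside sq)) ⟩
    ⌊ length w /2⌋       ∎
    where open ≤-Reasoning

  SQAbelOfLength≤blocks : ∀ (w : Word σ) ℓ → SQAbelOfLength w ℓ ≤ blocks w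
  SQAbelOfLength≤blocks w ℓ =
    ≤-trans (length-deduplicate-abSqParikhs≤ {ok} {w} {1} (λ _ → Fin.zero) sameHalf) (≤-reflexive (*-identityˡ (blocks w)))
    where
      ok : ℕ → Bool
      ok k = does (k ≟ ℓ)

      sameHalf : ∀ {x y} (o : Occurrence ok w x) (o′ : Occurrence ok w y) → Fin.zero ≡ Fin.zero → half o ≡ half o′
      sameHalf o o′ _ = m+m≡n+n⇒m≡n (trans (does⇒ (_ ≟ ℓ) (length-ok o)) (sym (does⇒ (_ ≟ ℓ) (length-ok o′))))

  SQAbel≤⌊length/2⌋*blocks : ∀ (w : Word σ) → SQAbel w ≤ ⌊ length w /2⌋ * blocks w
  SQAbel≤⌊length/2⌋*blocks w = length-deduplicate-abSqParikhs≤ {λ _ → true} {w}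
    (λ o → fromℕ< (half∸1<⌊length/2⌋ (square o)))
    (λ o o′ same → ∸-cancelʳ-≡ (half-positive (square o)) (half-positive (square o′)) (fromℕ<-injective _ _ _ _ same))

theorem14 : ∀ {σ : ℕ} (w : Word σ) →
    (∀ (ℓ : ℕ) → SQAbelOfLength w ℓ ≤ blocks w)
    × (2 * SQAbel w ≤ length w * blocks w)
theorem14 w = SQAbelOfLength≤blocks w , (begin
  2 * SQAbel w                 ≤⟨ *-monoʳ-≤ 2 (SQAbel≤⌊length/2⌋*blocks w) ⟩
  2 * (⌊ n /2⌋ * blocks w)     ≡⟨ *-assoc 2 ⌊ n /2⌋ (blocks w) ⟨
  2 * ⌊ n /2⌋ * blocks w       ≤⟨ *-monoˡ-≤ (blocks w) (2*⌊n/2⌋≤n n) ⟩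
  n * blocks w                 ∎)
  where
    open ≤-Reasoning
    n = length w
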